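{- Let $\lambda$ be a nonzero real number. For every integer $n\ge 0$, $$\sum_{l=0}^{n}F_{l,\lambda}(1)S_{1,\lambda}(n,l)=\sum_{l=0}^{n}\binom{n}{l}d_{l,\lambda}(1)_{n-l,\lambda}=\sum_{l=0}^{n}\binom{n}{l}d_{l,\lambda}(x)(1-x)_{n-l,\lambda}.$$
   Context: For a nonzero real $\lambda$, the degenerate falling factorial is $(x)_{0,\lambda}=1$ and $(x)_{n,\lambda}=x(x-\lambda)\cdots(x-(n-1)\lambda)$ for $n\ge1$. The degenerate exponential function is $e_{\lambda}^{x}(t)=(1+\lambda t)^{x/\lambda}=\sum_{n\ge0}(x)_{n,\lambda}\frac{t^n}{n!}$, $e_\lambda(t)=e_\lambda^1(t)$, and $\log_\lambda(t)=\frac{t^\lambda-1}{\lambda}$ is the compositional inverse of $e_\lambda(t)$. The degenerate derangement polynomials $d_{n,\lambda}(x)$ are defined by $\frac{1}{1-t}e_{\lambda}^{x-1}(t)=\sum_{n\ge0}d_{n,\lambda}(x)\frac{t^n}{n!}$, and $d_{n,\lambda}=d_{n,\lambda}(0)$. The degenerate Fubini polynomials $F_{n,\lambda}(y)$ are defined by $\frac{1}{1-y(e_{\lambda}(t)-1)}=\sum_{n\ge0}F_{n,\lambda}(y)\frac{t^n}{n!}$. The degenerate Stirling numbers of the first kind $S_{1,\lambda}(n,m)$ are defined by $\frac{1}{m!}(\log_\lambda(1+t))^m=\sum_{n\ge m}S_{1,\lambda}(n,m)\frac{t^n}{n!}$ for $m\ge0$.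
   Formalization: The parameter λ is a nonzero rational rather than a nonzero real, and the variable x ranges over the rationals. -}

module Defs where

open import Data.Nat.Base as ℕ using (ℕ; zero; suc; _∸_; _!)
open import Data.Nat.Properties using (_!≢0)
open import Data.Nat.Combinatorics using (_C_)
open import Data.Integer.Base using (+_)
open import Data.Rational.Base using (ℚ; _+_; _*_; _-_; _/_; _÷_; NonZero; 0ℚ; 1ℚ)

fromℕ : ℕ → ℚ
fromℕ n = (+ n) / 1

invFact : ℕ → ℚ
invFact n = (+ 1) / (n !)
  where instance _ = n !≢0

sumTo : ℕ → (ℕ → ℚ) → ℚ
sumTo zero    f = f 0
sumTo (suc n) f = sumTo n f + f (suc n)

_^ℚ_ : ℚ → ℕ → ℚ
y ^ℚ zero  = 1ℚ
y ^ℚ suc k = y * (y ^ℚ k)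

fallλ : (lam x : ℚ) → ℕ → ℚ
fallλ lam x zero    = 1ℚ
fallλ lam x (suc n) = fallλ lam x n * (x - fromℕ n * lam)

-- Formal power series in t over ℚ, given by ORDINARY coefficients:
-- f : Series represents  Σ_n f n · t^n.

Series : Set
Series = ℕ → ℚ

δ₀ : Series
δ₀ zero    = 1ℚ
δ₀ (suc n) = 0ℚ

_⊛_ : Series → Series → Series
(f ⊛ g) n = sumTo n (λ k → f k * g (n ∸ k))

_^ₛ_ : Series → ℕ → Series
f ^ₛ zero  = δ₀
f ^ₛ suc k = f ⊛ (f ^ₛ k)

geomSeries : Series
geomSeries n = 1ℚ

expλ : (lam x : ℚ) → Series
expλ lam x n = fallλ lam x n * invFact n

expλ-1 : (lam : ℚ) → Series
expλ-1 lam n = expλ lam 1ℚ n - δ₀ n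

-- (1+t)^λ = Σ (λ)_n t^n/n!   (ordinary falling factorial (λ)_n = (λ)_{n,1})
binomSeries : (lam : ℚ) → Series
binomSeries lam n = fallλ 1ℚ lam n * invFact n

logλ1+ : (lam : ℚ) → .{{NonZero lam}} → Series
logλ1+ lam n = (binomSeries lam n - δ₀ n) ÷ lam

-- Degenerate derangement polynomials:
-- 1/(1-t) e_λ^{x-1}(t) = Σ d_{n,λ}(x) t^n/n!
dλ : (lam x : ℚ) → ℕ → ℚ
dλ lam x n = fromℕ (n !) * (geomSeries ⊛ expλ lam (x - 1ℚ)) n

dλ₀ : (lam : ℚ) → ℕ → ℚ
dλ₀ lam n = dλ lam 0ℚ n

-- Degenerate Fubini polynomials:
-- 1/(1 - y(e_λ(t)-1)) = Σ_k y^k (e_λ(t)-1)^k = Σ F_{n,λ}(y) t^n/n!.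
-- Since (e_λ(t)-1)^k has no terms of degree < k, the coefficient of t^n
-- only receives contributions from k ≤ n.
Fλ : (lam y : ℚ) → ℕ → ℚ
Fλ lam y n = fromℕ (n !) * sumTo n (λ k → (y ^ℚ k) * ((expλ-1 lam ^ₛ k) n))

-- Degenerate Stirling numbers of the first kind:
-- (1/m!) (log_λ(1+t))^m = Σ_n S_{1,λ}(n,m) t^n/n!
S1λ : (lam : ℚ) → .{{NonZero lam}} → ℕ → ℕ → ℚ
S1λ lam n m = fromℕ (n !) * (invFact m * ((logλ1+ lam ^ₛ m) n))

binom : ℕ → ℕ → ℚ
binom n l = fromℕ (n C l)

-- All three sums equal n!.  The Fubini–Stirling sum is n! times the coefficient of t^n in
-- Σ_k (e_λ(log_λ(1+t)) - 1)^k, and the derangement sums are n! times the coefficient of t^n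
-- in (1/(1-t)) e_λ^{x-1}(t) e_λ^{1-x}(t).  Both series are 1/(1-t), because
-- e_λ(log_λ(1+t)) = 1 + t and e_λ^a(t) e_λ^b(t) = e_λ^{a+b}(t).
--
-- These two identities are uniqueness statements for linear differential equations
-- B·F′ = M·F with B(0) = 1, whose coefficient of t^n determines F_{n+1} from F_0, …, F_n:
-- e_λ^c(t) solves (1+λt)·F′ = c·F, and both e_λ(log_λ(1+t)) and 1 + t solve
-- (1+t)^λ·F′ = (log_λ(1+t))′·F.
module Submission where

open import Algebra.Bundles using (CommutativeMonoid)
open import Data.Integer.Base as ℤ using ()
import Data.Integer.Properties as ℤ
open import Data.Nat.Base as ℕ using (ℕ; zero; suc; _∸_; _!; z≤n; s≤s; _≤′_)
open import Data.Nat.Combinatorics using (_C_; nCk≡n!/k![n-k]!; k![n∸k]!∣n!)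
import Data.Nat.Coprimality as Coprimality
open import Data.Nat.DivMod using (m/n*n≡m)
open import Data.Nat.Induction using (<-rec)
import Data.Nat.Properties as ℕ
open import Data.Nat.Properties using (_!≢0; _!*_!≢0)
open import Data.Product.Base using (_×_; _,_)
open import Data.Rational.Base using (ℚ; mkℚ; _+_; _*_; _-_; _/_; 1/_; NonZero; 0ℚ; 1ℚ)
open import Data.Rational.Properties
open import Relation.Binary.PropositionalEquality
import Relation.Binary.Reasoning.Setoid as SetoidReasoning
open import Relation.Nullary.Decidable using (dec⇒maybe)
open import Tactic.RingSolver using (solve-∀)
open import Tactic.RingSolver.Core.AlmostCommutativeRing using (AlmostCommutativeRing; fromCommutativeRing)

open import Defs

open import Algebra.Properties.Group +-0-group using (x∙y⁻¹≈ε⇒x≈y)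
open import Algebra.Properties.CommutativeSemigroup
  (CommutativeMonoid.commutativeSemigroup *-1-commutativeMonoid)
  using (x∙yz≈y∙xz; x∙yz≈yx∙z; xy∙z≈y∙xz)

ℚ-ring : AlmostCommutativeRing _ _
ℚ-ring = fromCommutativeRing +-*-commutativeRing (λ x → dec⇒maybe (0ℚ ≟ x))

+-interchange : ∀ a b c d → (a + b) + (c + d) ≡ (a + c) + (b + d)
+-interchange = solve-∀ ℚ-ring

+--interchange : ∀ a b c d → (a - b) + (c - d) ≡ (a + c) - (b + d)
+--interchange = solve-∀ ℚ-ring

*-distribˡ-- : ∀ a b c → a * (b - c) ≡ a * b - a * c
*-distribˡ-- = solve-∀ ℚ-ring

*-distribʳ-- : ∀ a b c → (a - b) * c ≡ a * c - b * c
*-distribʳ-- = solve-∀ ℚ-ring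

^ℚ-zeroˡ : ∀ k → 1ℚ ^ℚ k ≡ 1ℚ
^ℚ-zeroˡ zero    = refl
^ℚ-zeroˡ (suc k) = trans (cong (1ℚ *_) (^ℚ-zeroˡ k)) (*-identityˡ 1ℚ)

fromℕ≡mkℚ : ∀ n → fromℕ n ≡ mkℚ (ℤ.+ n) 0 (Coprimality.sym (Coprimality.1-coprimeTo n))
fromℕ≡mkℚ n = normalize-coprime _

fromℕ-suc : ∀ n → fromℕ (suc n) ≡ 1ℚ + fromℕ n
fromℕ-suc n rewrite fromℕ≡mkℚ n | fromℕ≡mkℚ (suc n) =
  trans (sym (normalize-coprime _)) (/-cong (cong (ℤ._+_ ℤ.1ℤ) (sym (ℤ.*-identityʳ (ℤ.+ n)))) refl)

fromℕ-+ : ∀ m n → fromℕ (m ℕ.+ n) ≡ fromℕ m + fromℕ n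
fromℕ-+ zero    n = sym (+-identityˡ (fromℕ n))
fromℕ-+ (suc m) n = begin
  fromℕ (suc m ℕ.+ n)       ≡⟨ fromℕ-suc (m ℕ.+ n) ⟩
  1ℚ + fromℕ (m ℕ.+ n)      ≡⟨ cong (1ℚ +_) (fromℕ-+ m n) ⟩
  1ℚ + (fromℕ m + fromℕ n)  ≡⟨ +-assoc 1ℚ (fromℕ m) (fromℕ n) ⟨
  1ℚ + fromℕ m + fromℕ n    ≡⟨ cong (_+ fromℕ n) (fromℕ-suc m) ⟨
  fromℕ (suc m) + fromℕ n   ∎
  where open ≡-Reasoning

fromℕ-* : ∀ m n → fromℕ (m ℕ.* n) ≡ fromℕ m * fromℕ n
fromℕ-* zero    n = sym (*-zeroˡ (fromℕ n))
fromℕ-* (suc m) n = begin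
  fromℕ (n ℕ.+ m ℕ.* n)             ≡⟨ fromℕ-+ n (m ℕ.* n) ⟩
  fromℕ n + fromℕ (m ℕ.* n)         ≡⟨ cong₂ _+_ (sym (*-identityˡ (fromℕ n))) (fromℕ-* m n) ⟩
  1ℚ * fromℕ n + fromℕ m * fromℕ n  ≡⟨ *-distribʳ-+ (fromℕ n) 1ℚ (fromℕ m) ⟨
  (1ℚ + fromℕ m) * fromℕ n          ≡⟨ cong (_* fromℕ n) (fromℕ-suc m) ⟨
  fromℕ (suc m) * fromℕ n           ∎
  where open ≡-Reasoning

fromℕ-*-inverse : ∀ n .{{_ : ℕ.NonZero n}} → fromℕ n * (ℤ.1ℤ / n) ≡ 1ℚ
fromℕ-*-inverse (suc k) rewrite fromℕ≡mkℚ (suc k) =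
  trans (cong (p *_) (normalize-coprime (Coprimality.1-coprimeTo (suc k)))) (*-inverseʳ p)
  where p = mkℚ (ℤ.+ suc k) 0 (Coprimality.sym (Coprimality.1-coprimeTo (suc k)))

fromℕ-suc*x≡0⇒x≡0 : ∀ n {x} → fromℕ (suc n) * x ≡ 0ℚ → x ≡ 0ℚ
fromℕ-suc*x≡0⇒x≡0 n {x} sx≡0 = begin
  x            ≡⟨ *-identityˡ x ⟨
  1ℚ * x       ≡⟨ cong (_* x) (fromℕ-*-inverse (suc n)) ⟨
  s * i * x    ≡⟨ xy∙z≈y∙xz s i x ⟩
  i * (s * x)  ≡⟨ cong (i *_) sx≡0 ⟩
  i * 0ℚ       ≡⟨ *-zeroʳ i ⟩
  0ℚ           ∎
  where
  open ≡-Reasoning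
  s = fromℕ (suc n)
  i = ℤ.1ℤ / suc n

fromℕ[n!]*invFact : ∀ n → fromℕ (n !) * invFact n ≡ 1ℚ
fromℕ[n!]*invFact n = fromℕ-*-inverse (n !) {{n !≢0}}

fromℕ-suc*invFact-suc : ∀ n → fromℕ (suc n) * invFact (suc n) ≡ invFact n
fromℕ-suc*invFact-suc n = begin
  s * I′                      ≡⟨ *-identityʳ (s * I′) ⟨
  s * I′ * 1ℚ                 ≡⟨ cong (s * I′ *_) (fromℕ[n!]*invFact n) ⟨
  s * I′ * (N * I)            ≡⟨ rearrange s I′ N I ⟩
  I * (s * N * I′)            ≡⟨ cong (λ m → I * (m * I′)) (fromℕ-* (suc n) (n !)) ⟨
  I * (fromℕ (suc n !) * I′)  ≡⟨ cong (I *_) (fromℕ[n!]*invFact (suc n)) ⟩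
  I * 1ℚ                      ≡⟨ *-identityʳ I ⟩
  I                           ∎
  where
  open ≡-Reasoning
  s = fromℕ (suc n)
  N = fromℕ (n !)
  I = invFact n
  I′ = invFact (suc n)
  rearrange : ∀ s I′ N I → s * I′ * (N * I) ≡ I * (s * N * I′)
  rearrange = solve-∀ ℚ-ring

binom*l!*[n∸l]!≡n! : ∀ {n l} → l ℕ.≤ n →
                     binom n l * fromℕ (l !) * fromℕ ((n ∸ l) !) ≡ fromℕ (n !)
binom*l!*[n∸l]!≡n! {n} {l} l≤n = begin
  binom n l * fromℕ (l !) * fromℕ ((n ∸ l) !)
    ≡⟨ cong (_* fromℕ ((n ∸ l) !)) (fromℕ-* (n C l) (l !)) ⟨
  fromℕ ((n C l) ℕ.* l !) * fromℕ ((n ∸ l) !)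
    ≡⟨ fromℕ-* ((n C l) ℕ.* l !) ((n ∸ l) !) ⟨
  fromℕ ((n C l) ℕ.* l ! ℕ.* (n ∸ l) !)
    ≡⟨ cong fromℕ nCl*l!*[n∸l]!≡n! ⟩
  fromℕ (n !)
    ∎
  where
  open ≡-Reasoning
  nCl*l!*[n∸l]!≡n! : (n C l) ℕ.* l ! ℕ.* (n ∸ l) ! ≡ n !
  nCl*l!*[n∸l]!≡n! = trans (ℕ.*-assoc (n C l) (l !) ((n ∸ l) !))
    (trans (cong (ℕ._* (l ! ℕ.* (n ∸ l) !)) (nCk≡n!/k![n-k]! l≤n))
           (m/n*n≡m {{l !* (n ∸ l) !≢0}} (k![n∸k]!∣n! l≤n)))

sumTo-cong-≤ : ∀ n {f g : ℕ → ℚ} → (∀ i → i ℕ.≤ n → f i ≡ g i) → sumTo n f ≡ sumTo n g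
sumTo-cong-≤ zero    f≡g = f≡g 0 z≤n
sumTo-cong-≤ (suc n) f≡g =
  cong₂ _+_ (sumTo-cong-≤ n (λ i i≤n → f≡g i (ℕ.m≤n⇒m≤1+n i≤n))) (f≡g (suc n) ℕ.≤-refl)

sumTo-cong : ∀ n {f g : ℕ → ℚ} → f ≗ g → sumTo n f ≡ sumTo n g
sumTo-cong n f≗g = sumTo-cong-≤ n (λ i _ → f≗g i)

sumTo-zero : ∀ n {f : ℕ → ℚ} → (∀ i → i ℕ.≤ n → f i ≡ 0ℚ) → sumTo n f ≡ 0ℚ
sumTo-zero zero    f≡0 = f≡0 0 z≤n
sumTo-zero (suc n) f≡0 =
  cong₂ _+_ (sumTo-zero n (λ i i≤n → f≡0 i (ℕ.m≤n⇒m≤1+n i≤n))) (f≡0 (suc n) ℕ.≤-refl)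

sumTo-+ : ∀ n (f g : ℕ → ℚ) → sumTo n (λ i → f i + g i) ≡ sumTo n f + sumTo n g
sumTo-+ zero    f g = refl
sumTo-+ (suc n) f g = trans (cong (_+ (f (suc n) + g (suc n))) (sumTo-+ n f g))
                            (+-interchange (sumTo n f) (sumTo n g) (f (suc n)) (g (suc n)))

sumTo-- : ∀ n (f g : ℕ → ℚ) → sumTo n (λ i → f i - g i) ≡ sumTo n f - sumTo n g
sumTo-- zero    f g = refl
sumTo-- (suc n) f g = trans (cong (_+ (f (suc n) - g (suc n))) (sumTo-- n f g))
                            (+--interchange (sumTo n f) (sumTo n g) (f (suc n)) (g (suc n)))

*-distribˡ-sumTo : ∀ n c (f : ℕ → ℚ) → c * sumTo n f ≡ sumTo n (λ i → c * f i)
*-distribˡ-sumTo zero    c f = refl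
*-distribˡ-sumTo (suc n) c f =
  trans (*-distribˡ-+ c (sumTo n f) (f (suc n))) (cong (_+ c * f (suc n)) (*-distribˡ-sumTo n c f))

*-distribʳ-sumTo : ∀ n c (f : ℕ → ℚ) → sumTo n f * c ≡ sumTo n (λ i → f i * c)
*-distribʳ-sumTo n c f =
  trans (*-comm (sumTo n f) c) (trans (*-distribˡ-sumTo n c f) (sumTo-cong n (λ i → *-comm c (f i))))

sumTo-*-sumTo : ∀ n m (f g : ℕ → ℚ) →
                sumTo n f * sumTo m g ≡ sumTo n (λ i → sumTo m (λ j → f i * g j))
sumTo-*-sumTo n m f g =
  trans (*-distribʳ-sumTo n (sumTo m g) f) (sumTo-cong n (λ i → *-distribˡ-sumTo m (f i) g))

sumTo-suc : ∀ n (f : ℕ → ℚ) → sumTo (suc n) f ≡ f 0 + sumTo n (λ i → f (suc i))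
sumTo-suc zero    f = refl
sumTo-suc (suc n) f =
  trans (cong (_+ f (suc (suc n))) (sumTo-suc n f)) (+-assoc (f 0) _ (f (suc (suc n))))

sumTo-head : ∀ n {f : ℕ → ℚ} → (∀ i → f (suc i) ≡ 0ℚ) → sumTo n f ≡ f 0
sumTo-head zero    f≡0 = refl
sumTo-head (suc n) f≡0 = trans (cong₂ _+_ (sumTo-head n f≡0) (f≡0 n)) (+-identityʳ _)

sumTo-last : ∀ n {f : ℕ → ℚ} → (∀ i → i ℕ.< n → f i ≡ 0ℚ) → sumTo n f ≡ f n
sumTo-last zero        f≡0 = refl
sumTo-last (suc n) {f} f≡0 =
  trans (cong (_+ f (suc n)) (sumTo-zero n (λ i i≤n → f≡0 i (s≤s i≤n)))) (+-identityˡ (f (suc n)))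

sumTo-extend : ∀ {a b} {f : ℕ → ℚ} → a ℕ.≤ b → (∀ i → a ℕ.< i → f i ≡ 0ℚ) →
               sumTo b f ≡ sumTo a f
sumTo-extend {a} {f = f} a≤b f≡0 = go (ℕ.≤⇒≤′ a≤b)
  where
  go : ∀ {b} → a ≤′ b → sumTo b f ≡ sumTo a f
  go ℕ.≤′-refl            = refl
  go (ℕ.≤′-step {b} a≤′b) =
    trans (cong₂ _+_ (go a≤′b) (f≡0 (suc b) (s≤s (ℕ.≤′⇒≤ a≤′b)))) (+-identityʳ (sumTo a f))

sumTo-reverse : ∀ n (f : ℕ → ℚ) → sumTo n f ≡ sumTo n (λ i → f (n ∸ i))
sumTo-reverse zero    f = refl
sumTo-reverse (suc n) f = begin
  sumTo n f + f (suc n)                  ≡⟨ +-comm (sumTo n f) (f (suc n)) ⟩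
  f (suc n) + sumTo n f                  ≡⟨ cong (f (suc n) +_) (sumTo-reverse n f) ⟩
  f (suc n) + sumTo n (λ i → f (n ∸ i))  ≡⟨ sumTo-suc n (λ i → f (suc n ∸ i)) ⟨
  sumTo (suc n) (λ i → f (suc n ∸ i))    ∎
  where open ≡-Reasoning

sumTo-swap : ∀ n m (F : ℕ → ℕ → ℚ) →
             sumTo n (λ i → sumTo m (F i)) ≡ sumTo m (λ j → sumTo n (λ i → F i j))
sumTo-swap zero    m F = refl
sumTo-swap (suc n) m F =
  trans (cong (_+ sumTo m (F (suc n))) (sumTo-swap n m F)) (sym (sumTo-+ m _ (F (suc n))))

sumTo-triangle : ∀ n (F : ℕ → ℕ → ℚ) →
                 sumTo n (λ k → sumTo k (λ i → F i k))
                 ≡ sumTo n (λ i → sumTo (n ∸ i) (λ j → F i (i ℕ.+ j)))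
sumTo-triangle zero    F = refl
sumTo-triangle (suc n) F = begin
  sumTo (suc n) (λ k → sumTo k (λ i → F i k))
    ≡⟨ sumTo-suc n _ ⟩
  F 0 0 + sumTo n (λ k → sumTo (suc k) (λ i → F i (suc k)))
    ≡⟨ cong (F 0 0 +_) (trans (sumTo-cong n (λ k → sumTo-suc k _)) (sumTo-+ n _ _)) ⟩
  F 0 0 + (sumTo n (λ k → F 0 (suc k)) + sumTo n (λ k → sumTo k (λ i → F (suc i) (suc k))))
    ≡⟨ +-assoc (F 0 0) _ _ ⟨
  F 0 0 + sumTo n (λ k → F 0 (suc k)) + sumTo n (λ k → sumTo k (λ i → F (suc i) (suc k)))
    ≡⟨ cong₂ _+_ (sym (sumTo-suc n (F 0))) (sumTo-triangle n (λ i k → F (suc i) (suc k))) ⟩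
  sumTo (suc n) (F 0) + sumTo n (λ i → sumTo (n ∸ i) (λ j → F (suc i) (suc i ℕ.+ j)))
    ≡⟨ sumTo-suc n _ ⟨
  sumTo (suc n) (λ i → sumTo (suc n ∸ i) (λ j → F i (i ℕ.+ j)))
    ∎
  where open ≡-Reasoning

-- Formal power series

module ≗-Reasoning = SetoidReasoning (ℕ →-setoid ℚ)

infixl 6 _⊕_ _⊖_
infixr 7 _·ₛ_

_⊕_ : Series → Series → Series
(f ⊕ g) n = f n + g n

_⊖_ : Series → Series → Series
(f ⊖ g) n = f n - g n

_·ₛ_ : ℚ → Series → Series
(c ·ₛ f) n = c * f n

X : Series
X zero          = 0ℚ
X (suc zero)    = 1ℚ
X (suc (suc n)) = 0ℚ

⊕-cong : ∀ {f f′ g g′} → f ≗ f′ → g ≗ g′ → f ⊕ g ≗ f′ ⊕ g′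
⊕-cong f≗f′ g≗g′ n = cong₂ _+_ (f≗f′ n) (g≗g′ n)

⊕-congˡ : ∀ f {g g′} → g ≗ g′ → f ⊕ g ≗ f ⊕ g′
⊕-congˡ f = ⊕-cong {f} (λ _ → refl)

⊖-cong : ∀ {f f′ g g′} → f ≗ f′ → g ≗ g′ → f ⊖ g ≗ f′ ⊖ g′
⊖-cong f≗f′ g≗g′ n = cong₂ _-_ (f≗f′ n) (g≗g′ n)

·ₛ-congˡ : ∀ c {f g} → f ≗ g → c ·ₛ f ≗ c ·ₛ g
·ₛ-congˡ c f≗g n = cong (c *_) (f≗g n)

⊛-cong : ∀ {f f′ g g′} → f ≗ f′ → g ≗ g′ → f ⊛ g ≗ f′ ⊛ g′
⊛-cong f≗f′ g≗g′ n = sumTo-cong n (λ k → cong₂ _*_ (f≗f′ k) (g≗g′ (n ∸ k)))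

⊛-congˡ : ∀ f {g g′} → g ≗ g′ → f ⊛ g ≗ f ⊛ g′
⊛-congˡ f = ⊛-cong {f} (λ _ → refl)

⊛-congʳ : ∀ g {f f′} → f ≗ f′ → f ⊛ g ≗ f′ ⊛ g
⊛-congʳ g f≗f′ = ⊛-cong {g = g} f≗f′ (λ _ → refl)

⊛-comm : ∀ f g → f ⊛ g ≗ g ⊛ f
⊛-comm f g n = trans (sumTo-reverse n _) (sumTo-cong-≤ n λ i i≤n →
  trans (cong (λ j → f (n ∸ i) * g j) (ℕ.m∸[m∸n]≡n i≤n)) (*-comm (f (n ∸ i)) (g i)))

⊛-assoc : ∀ f g h → (f ⊛ g) ⊛ h ≗ f ⊛ (g ⊛ h)
⊛-assoc f g h n = begin
  sumTo n (λ k → sumTo k (λ i → f i * g (k ∸ i)) * h (n ∸ k))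
    ≡⟨ sumTo-cong n (λ k → *-distribʳ-sumTo k (h (n ∸ k)) _) ⟩
  sumTo n (λ k → sumTo k (λ i → f i * g (k ∸ i) * h (n ∸ k)))
    ≡⟨ sumTo-triangle n _ ⟩
  sumTo n (λ i → sumTo (n ∸ i) (λ j → f i * g (i ℕ.+ j ∸ i) * h (n ∸ (i ℕ.+ j))))
    ≡⟨ sumTo-cong n (λ i → sumTo-cong (n ∸ i) (reindex i)) ⟩
  sumTo n (λ i → sumTo (n ∸ i) (λ j → f i * (g j * h (n ∸ i ∸ j))))
    ≡⟨ sumTo-cong n (λ i → *-distribˡ-sumTo (n ∸ i) (f i) _) ⟨
  sumTo n (λ i → f i * sumTo (n ∸ i) (λ j → g j * h (n ∸ i ∸ j)))
    ∎
  where
  open ≡-Reasoning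
  reindex : ∀ i j → f i * g (i ℕ.+ j ∸ i) * h (n ∸ (i ℕ.+ j)) ≡ f i * (g j * h (n ∸ i ∸ j))
  reindex i j = trans (cong₂ (λ a b → f i * g a * h b) (ℕ.m+n∸m≡n i j) (sym (ℕ.∸-+-assoc n i j)))
                      (*-assoc (f i) (g j) (h (n ∸ i ∸ j)))

⊛-identityˡ : ∀ f → δ₀ ⊛ f ≗ f
⊛-identityˡ f n = trans (sumTo-head n (λ i → *-zeroˡ (f (n ∸ suc i)))) (*-identityˡ (f n))

⊛-identityʳ : ∀ f → f ⊛ δ₀ ≗ f
⊛-identityʳ f n = trans (⊛-comm f δ₀ n) (⊛-identityˡ f n)

⊛-distribʳ-⊕ : ∀ f g h → (f ⊕ g) ⊛ h ≗ f ⊛ h ⊕ g ⊛ h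
⊛-distribʳ-⊕ f g h n =
  trans (sumTo-cong n (λ i → *-distribʳ-+ (h (n ∸ i)) (f i) (g i))) (sumTo-+ n _ _)

⊛-distribˡ-⊕ : ∀ f g h → f ⊛ (g ⊕ h) ≗ f ⊛ g ⊕ f ⊛ h
⊛-distribˡ-⊕ f g h n =
  trans (sumTo-cong n (λ i → *-distribˡ-+ (f i) (g (n ∸ i)) (h (n ∸ i)))) (sumTo-+ n _ _)

⊛-distribˡ-⊖ : ∀ f g h → f ⊛ (g ⊖ h) ≗ f ⊛ g ⊖ f ⊛ h
⊛-distribˡ-⊖ f g h n =
  trans (sumTo-cong n (λ i → *-distribˡ-- (f i) (g (n ∸ i)) (h (n ∸ i)))) (sumTo-- n _ _)

⊛-·ˡ : ∀ c f g → (c ·ₛ f) ⊛ g ≗ c ·ₛ (f ⊛ g)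
⊛-·ˡ c f g n =
  trans (sumTo-cong n (λ i → *-assoc c (f i) (g (n ∸ i)))) (sym (*-distribˡ-sumTo n c _))

⊛-·ʳ : ∀ c f g → f ⊛ (c ·ₛ g) ≗ c ·ₛ (f ⊛ g)
⊛-·ʳ c f g n =
  trans (sumTo-cong n (λ i → x∙yz≈y∙xz (f i) c (g (n ∸ i)))) (sym (*-distribˡ-sumTo n c _))

^ₛ-cong : ∀ {f g} k → f ≗ g → f ^ₛ k ≗ g ^ₛ k
^ₛ-cong zero    f≗g _ = refl
^ₛ-cong (suc k) f≗g   = ⊛-cong f≗g (^ₛ-cong k f≗g)

^ₛ-+ : ∀ f i j → f ^ₛ (i ℕ.+ j) ≗ (f ^ₛ i) ⊛ (f ^ₛ j)
^ₛ-+ f zero    j n = sym (⊛-identityˡ (f ^ₛ j) n)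
^ₛ-+ f (suc i) j n = trans (⊛-congˡ f (^ₛ-+ f i j) n) (sym (⊛-assoc f (f ^ₛ i) (f ^ₛ j) n))

^ₛ-vanish : ∀ {f} → f 0 ≡ 0ℚ → ∀ {i k} → i ℕ.< k → (f ^ₛ k) i ≡ 0ℚ
^ₛ-vanish {f} f₀≡0 {i} {suc k} i<1+k = sumTo-zero i term≡0
  where
  term≡0 : ∀ j → j ℕ.≤ i → f j * (f ^ₛ k) (i ∸ j) ≡ 0ℚ
  term≡0 zero    _     = trans (cong (_* (f ^ₛ k) i) f₀≡0) (*-zeroˡ ((f ^ₛ k) i))
  term≡0 (suc j) 1+j≤i = trans (cong (f (suc j) *_) (^ₛ-vanish f₀≡0 i∸[1+j]<k)) (*-zeroʳ (f (suc j)))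
    where
    i∸[1+j]<k : i ∸ suc j ℕ.< k
    i∸[1+j]<k = ℕ.<-≤-trans (ℕ.∸-monoʳ-< (s≤s z≤n) 1+j≤i) (ℕ.≤-pred i<1+k)

X⊛-zero : ∀ f → (X ⊛ f) 0 ≡ 0ℚ
X⊛-zero f = *-zeroˡ (f 0)

X⊛-suc : ∀ f n → (X ⊛ f) (suc n) ≡ f n
X⊛-suc f n = begin
  (X ⊛ f) (suc n)
    ≡⟨ sumTo-suc n _ ⟩
  0ℚ * f (suc n) + sumTo n (λ i → X (suc i) * f (n ∸ i))
    ≡⟨ cong₂ _+_ (*-zeroˡ (f (suc n))) (sumTo-head n (λ i → *-zeroˡ (f (n ∸ suc i)))) ⟩
  0ℚ + 1ℚ * f n
    ≡⟨ trans (+-identityˡ (1ℚ * f n)) (*-identityˡ (f n)) ⟩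
  f n
    ∎
  where open ≡-Reasoning

X^ₛ-diag : ∀ n → (X ^ₛ n) n ≡ 1ℚ
X^ₛ-diag zero    = refl
X^ₛ-diag (suc n) = trans (X⊛-suc (X ^ₛ n) n) (X^ₛ-diag n)

X^ₛ-below : ∀ {k n} → k ℕ.< n → (X ^ₛ k) n ≡ 0ℚ
X^ₛ-below {zero}  {suc n} _         = refl
X^ₛ-below {suc k} {suc n} (s≤s k<n) = trans (X⊛-suc (X ^ₛ k) n) (X^ₛ-below k<n)

-- Derivatives

D : Series → Series
D f n = fromℕ (suc n) * f (suc n)

-- The Euler operator t·d/dt: unlike D it involves no index shift, so its Leibniz rule
-- is a plain splitting n = i + (n ∸ i) of the weight.
θ : Series → Series
θ f n = fromℕ n * f n

D-cong : ∀ {f g} → f ≗ g → D f ≗ D g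
D-cong f≗g n = cong (fromℕ (suc n) *_) (f≗g (suc n))

D-⊖ : ∀ f g → D (f ⊖ g) ≗ D f ⊖ D g
D-⊖ f g n = *-distribˡ-- (fromℕ (suc n)) (f (suc n)) (g (suc n))

θ-⊛ : ∀ f g → θ (f ⊛ g) ≗ θ f ⊛ g ⊕ f ⊛ θ g
θ-⊛ f g n = trans (*-distribˡ-sumTo n (fromℕ n) _) (trans (sumTo-cong-≤ n split) (sumTo-+ n _ _))
  where
  leibniz : ∀ a b x y → (a + b) * (x * y) ≡ a * x * y + x * (b * y)
  leibniz = solve-∀ ℚ-ring
  split : ∀ i → i ℕ.≤ n → fromℕ n * (f i * g (n ∸ i)) ≡ θ f i * g (n ∸ i) + f i * θ g (n ∸ i)
  split i i≤n = begin
    fromℕ n * (f i * g (n ∸ i))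
      ≡⟨ cong (λ m → fromℕ m * (f i * g (n ∸ i))) (ℕ.m+[n∸m]≡n i≤n) ⟨
    fromℕ (i ℕ.+ (n ∸ i)) * (f i * g (n ∸ i))
      ≡⟨ cong (_* (f i * g (n ∸ i))) (fromℕ-+ i (n ∸ i)) ⟩
    (fromℕ i + fromℕ (n ∸ i)) * (f i * g (n ∸ i))
      ≡⟨ leibniz (fromℕ i) (fromℕ (n ∸ i)) (f i) (g (n ∸ i)) ⟩
    θ f i * g (n ∸ i) + f i * θ g (n ∸ i)
      ∎
    where open ≡-Reasoning

θ⊛-suc : ∀ f g n → (θ f ⊛ g) (suc n) ≡ (D f ⊛ g) n
θ⊛-suc f g n = begin
  (θ f ⊛ g) (suc n)                   ≡⟨ sumTo-suc n _ ⟩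
  0ℚ * f 0 * g (suc n) + (D f ⊛ g) n  ≡⟨ cong (λ a → a * g (suc n) + (D f ⊛ g) n) (*-zeroˡ (f 0)) ⟩
  0ℚ * g (suc n) + (D f ⊛ g) n        ≡⟨ cong (_+ (D f ⊛ g) n) (*-zeroˡ (g (suc n))) ⟩
  0ℚ + (D f ⊛ g) n                    ≡⟨ +-identityˡ ((D f ⊛ g) n) ⟩
  (D f ⊛ g) n                         ∎
  where open ≡-Reasoning

D-⊛ : ∀ f g → D (f ⊛ g) ≗ D f ⊛ g ⊕ f ⊛ D g
D-⊛ f g n = begin
  θ (f ⊛ g) (suc n)                      ≡⟨ θ-⊛ f g (suc n) ⟩
  (θ f ⊛ g) (suc n) + (f ⊛ θ g) (suc n)  ≡⟨ cong ((θ f ⊛ g) (suc n) +_) (⊛-comm f (θ g) (suc n)) ⟩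
  (θ f ⊛ g) (suc n) + (θ g ⊛ f) (suc n)  ≡⟨ cong₂ _+_ (θ⊛-suc f g n) (θ⊛-suc g f n) ⟩
  (D f ⊛ g) n + (D g ⊛ f) n              ≡⟨ cong ((D f ⊛ g) n +_) (⊛-comm (D g) f n) ⟩
  (D f ⊛ g) n + (f ⊛ D g) n              ∎
  where open ≡-Reasoning

D-^ₛ : ∀ g m → D (g ^ₛ suc m) ≗ fromℕ (suc m) ·ₛ (g ^ₛ m) ⊛ D g
D-^ₛ g zero = begin
  D (g ⊛ δ₀)        ≈⟨ D-cong (⊛-identityʳ g) ⟩
  D g               ≈⟨ ⊛-identityˡ (D g) ⟨
  δ₀ ⊛ D g          ≈⟨ (λ n → *-identityˡ ((δ₀ ⊛ D g) n)) ⟨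
  1ℚ ·ₛ δ₀ ⊛ D g    ∎
  where open ≗-Reasoning
D-^ₛ g (suc m) = begin
  D (g ⊛ gᵐ⁺¹)
    ≈⟨ D-⊛ g gᵐ⁺¹ ⟩
  D g ⊛ gᵐ⁺¹ ⊕ g ⊛ D gᵐ⁺¹
    ≈⟨ ⊕-cong (⊛-comm (D g) gᵐ⁺¹) (⊛-congˡ g (D-^ₛ g m)) ⟩
  gᵐ⁺¹ ⊛ D g ⊕ g ⊛ (s ·ₛ gᵐ ⊛ D g)
    ≈⟨ ⊕-congˡ (gᵐ⁺¹ ⊛ D g) (⊛-·ʳ s g (gᵐ ⊛ D g)) ⟩
  gᵐ⁺¹ ⊛ D g ⊕ s ·ₛ g ⊛ (gᵐ ⊛ D g)
    ≈⟨ ⊕-congˡ (gᵐ⁺¹ ⊛ D g) (·ₛ-congˡ s (⊛-assoc g gᵐ (D g))) ⟨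
  gᵐ⁺¹ ⊛ D g ⊕ s ·ₛ gᵐ⁺¹ ⊛ D g
    ≈⟨ (λ n → collect s ((gᵐ⁺¹ ⊛ D g) n)) ⟩
  (1ℚ + s) ·ₛ gᵐ⁺¹ ⊛ D g
    ≈⟨ (λ n → cong (_* (gᵐ⁺¹ ⊛ D g) n) (fromℕ-suc (suc m))) ⟨
  fromℕ (suc (suc m)) ·ₛ gᵐ⁺¹ ⊛ D g
    ∎
  where
  open ≗-Reasoning
  gᵐ = g ^ₛ m
  gᵐ⁺¹ = g ^ₛ suc m
  s = fromℕ (suc m)
  collect : ∀ s y → y + s * y ≡ (1ℚ + s) * y
  collect = solve-∀ ℚ-ring

linear-ode-zero : ∀ {B M K} → B 0 ≡ 1ℚ → K 0 ≡ 0ℚ → B ⊛ D K ≗ M ⊛ K → ∀ n → K n ≡ 0ℚ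
linear-ode-zero {B} {M} {K} B₀≡1 K₀≡0 ode = <-rec (λ n → K n ≡ 0ℚ) step
  where
  step : ∀ n → (∀ {i} → i ℕ.< n → K i ≡ 0ℚ) → K n ≡ 0ℚ
  step zero    _    = K₀≡0
  step (suc n) K<≡0 = fromℕ-suc*x≡0⇒x≡0 n (begin
    D K n              ≡⟨ *-identityʳ (D K n) ⟨
    D K n * 1ℚ         ≡⟨ cong (D K n *_) B₀≡1 ⟨
    D K n * B 0        ≡⟨ cong (λ m → D K n * B m) (ℕ.n∸n≡0 n) ⟨
    D K n * B (n ∸ n)  ≡⟨ sumTo-last n DK*B≡0 ⟨
    (D K ⊛ B) n        ≡⟨ ⊛-comm (D K) B n ⟩
    (B ⊛ D K) n        ≡⟨ ode n ⟩
    (M ⊛ K) n          ≡⟨ sumTo-zero n (λ i _ → trans (cong (M i *_) (K[n∸i]≡0 i)) (*-zeroʳ (M i))) ⟩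
    0ℚ                 ∎)
    where
    open ≡-Reasoning
    DK*B≡0 : ∀ i → i ℕ.< n → D K i * B (n ∸ i) ≡ 0ℚ
    DK*B≡0 i i<n = trans (cong (_* B (n ∸ i)) DK≡0) (*-zeroˡ (B (n ∸ i)))
      where
      DK≡0 : D K i ≡ 0ℚ
      DK≡0 = trans (cong (fromℕ (suc i) *_) (K<≡0 (s≤s i<n))) (*-zeroʳ (fromℕ (suc i)))
    K[n∸i]≡0 : ∀ i → K (n ∸ i) ≡ 0ℚ
    K[n∸i]≡0 i = K<≡0 (s≤s (ℕ.m∸n≤m n i))

linear-ode-unique : ∀ {B M F G} → B 0 ≡ 1ℚ → F 0 ≡ G 0 →
                    B ⊛ D F ≗ M ⊛ F → B ⊛ D G ≗ M ⊛ G → F ≗ G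
linear-ode-unique {B} {M} {F} {G} B₀≡1 F₀≡G₀ odeF odeG n =
  x∙y⁻¹≈ε⇒x≈y (F n) (G n) (linear-ode-zero {B} {M} {F ⊖ G} B₀≡1 F₀-G₀≡0 ode n)
  where
  F₀-G₀≡0 : F 0 - G 0 ≡ 0ℚ
  F₀-G₀≡0 = trans (cong (_- G 0) F₀≡G₀) (+-inverseʳ (G 0))
  ode : B ⊛ D (F ⊖ G) ≗ M ⊛ (F ⊖ G)
  ode = begin
    B ⊛ D (F ⊖ G)      ≈⟨ ⊛-congˡ B (D-⊖ F G) ⟩
    B ⊛ (D F ⊖ D G)    ≈⟨ ⊛-distribˡ-⊖ B (D F) (D G) ⟩
    B ⊛ D F ⊖ B ⊛ D G  ≈⟨ ⊖-cong odeF odeG ⟩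
    M ⊛ F ⊖ M ⊛ G      ≈⟨ ⊛-distribˡ-⊖ M F G ⟨
    M ⊛ (F ⊖ G)        ∎
    where open ≗-Reasoning

-- Composition

-- f ∘ₛ g is the composite f(g(t)) when g 0 ≡ 0; the sum is truncated at l = n,
-- beyond which g ^ₛ l has no coefficient of t^n.
_∘ₛ_ : Series → Series → Series
(f ∘ₛ g) n = sumTo n (λ l → f l * (g ^ₛ l) n)

∘ₛ-cong : ∀ {f f′} g → f ≗ f′ → f ∘ₛ g ≗ f′ ∘ₛ g
∘ₛ-cong g f≗f′ n = sumTo-cong n (λ l → cong (_* (g ^ₛ l) n) (f≗f′ l))

∘ₛ-⊕ : ∀ f h g → (f ⊕ h) ∘ₛ g ≗ f ∘ₛ g ⊕ h ∘ₛ g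
∘ₛ-⊕ f h g n =
  trans (sumTo-cong n (λ l → *-distribʳ-+ ((g ^ₛ l) n) (f l) (h l))) (sumTo-+ n _ _)

∘ₛ-⊖ : ∀ f h g → (f ⊖ h) ∘ₛ g ≗ f ∘ₛ g ⊖ h ∘ₛ g
∘ₛ-⊖ f h g n =
  trans (sumTo-cong n (λ l → *-distribʳ-- (f l) (h l) ((g ^ₛ l) n))) (sumTo-- n _ _)

∘ₛ-· : ∀ c f g → (c ·ₛ f) ∘ₛ g ≗ c ·ₛ (f ∘ₛ g)
∘ₛ-· c f g n =
  trans (sumTo-cong n (λ l → *-assoc c (f l) ((g ^ₛ l) n))) (sym (*-distribˡ-sumTo n c _))

δ₀-∘ₛ : ∀ g → δ₀ ∘ₛ g ≗ δ₀
δ₀-∘ₛ g n = trans (sumTo-head n (λ l → *-zeroˡ ((g ^ₛ suc l) n))) (*-identityˡ (δ₀ n))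

module _ {g : Series} (g₀≡0 : g 0 ≡ 0ℚ) where

  ∘ₛ-extend : ∀ f {n m} → n ℕ.≤ m → (f ∘ₛ g) n ≡ sumTo m (λ l → f l * (g ^ₛ l) n)
  ∘ₛ-extend f n≤m =
    sym (sumTo-extend n≤m (λ l n<l → trans (cong (f l *_) (^ₛ-vanish g₀≡0 n<l)) (*-zeroʳ (f l))))

  X-∘ₛ : X ∘ₛ g ≗ g
  X-∘ₛ zero    = sym g₀≡0
  X-∘ₛ (suc n) = begin
    (X ∘ₛ g) (suc n)
      ≡⟨ sumTo-suc n _ ⟩
    0ℚ + sumTo n (λ l → X (suc l) * (g ^ₛ suc l) (suc n))
      ≡⟨ cong (0ℚ +_) (sumTo-head n (λ l → *-zeroˡ ((g ^ₛ suc (suc l)) (suc n)))) ⟩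
    0ℚ + 1ℚ * (g ⊛ δ₀) (suc n)
      ≡⟨ trans (+-identityˡ _) (*-identityˡ _) ⟩
    (g ⊛ δ₀) (suc n)
      ≡⟨ ⊛-identityʳ g (suc n) ⟩
    g (suc n)
      ∎
    where open ≡-Reasoning

  ∘ₛ-⊛ : ∀ p q → (p ⊛ q) ∘ₛ g ≗ (p ∘ₛ g) ⊛ (q ∘ₛ g)
  ∘ₛ-⊛ p q n = trans lhs≡T (sym rhs≡T)
    where
    open ≡-Reasoning
    T : ℚ
    T = sumTo n (λ i → sumTo n (λ j → p i * q j * (g ^ₛ (i ℕ.+ j)) n))
    vanish : ∀ {i j} → i ℕ.≤ n → n ∸ i ℕ.< j → p i * q j * (g ^ₛ (i ℕ.+ j)) n ≡ 0ℚ
    vanish {i} {j} i≤n n∸i<j =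
      trans (cong (p i * q j *_) (^ₛ-vanish g₀≡0 n<i+j)) (*-zeroʳ (p i * q j))
      where
      n<i+j : n ℕ.< i ℕ.+ j
      n<i+j = subst (ℕ._< i ℕ.+ j) (ℕ.m+[n∸m]≡n i≤n) (ℕ.+-monoʳ-< i n∸i<j)
    lhs≡T : ((p ⊛ q) ∘ₛ g) n ≡ T
    lhs≡T = begin
      sumTo n (λ m → sumTo m (λ i → p i * q (m ∸ i)) * (g ^ₛ m) n)
        ≡⟨ sumTo-cong n (λ m → *-distribʳ-sumTo m ((g ^ₛ m) n) _) ⟩
      sumTo n (λ m → sumTo m (λ i → p i * q (m ∸ i) * (g ^ₛ m) n))
        ≡⟨ sumTo-triangle n _ ⟩
      sumTo n (λ i → sumTo (n ∸ i) (λ j → p i * q (i ℕ.+ j ∸ i) * (g ^ₛ (i ℕ.+ j)) n))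
        ≡⟨ sumTo-cong n (λ i → sumTo-cong (n ∸ i) (λ j →
             cong (λ k → p i * q k * (g ^ₛ (i ℕ.+ j)) n) (ℕ.m+n∸m≡n i j))) ⟩
      sumTo n (λ i → sumTo (n ∸ i) (λ j → p i * q j * (g ^ₛ (i ℕ.+ j)) n))
        ≡⟨ sumTo-cong-≤ n (λ i i≤n → sym (sumTo-extend (ℕ.m∸n≤m n i) (λ j → vanish i≤n))) ⟩
      T ∎
    interchange : ∀ a x b y → a * x * (b * y) ≡ a * b * (x * y)
    interchange = solve-∀ ℚ-ring
    rhs≡T : ((p ∘ₛ g) ⊛ (q ∘ₛ g)) n ≡ T
    rhs≡T = begin
      sumTo n (λ k → (p ∘ₛ g) k * (q ∘ₛ g) (n ∸ k))
        ≡⟨ sumTo-cong-≤ n (λ k k≤n →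
             cong₂ _*_ (∘ₛ-extend p k≤n) (∘ₛ-extend q (ℕ.m∸n≤m n k))) ⟩
      sumTo n (λ k → sumTo n (λ i → p i * (g ^ₛ i) k) * sumTo n (λ j → q j * (g ^ₛ j) (n ∸ k)))
        ≡⟨ sumTo-cong n (λ k → sumTo-*-sumTo n n _ _) ⟩
      sumTo n (λ k → sumTo n (λ i → sumTo n (λ j → p i * (g ^ₛ i) k * (q j * (g ^ₛ j) (n ∸ k)))))
        ≡⟨ sumTo-swap n n _ ⟩
      sumTo n (λ i → sumTo n (λ k → sumTo n (λ j → p i * (g ^ₛ i) k * (q j * (g ^ₛ j) (n ∸ k)))))
        ≡⟨ sumTo-cong n (λ i → sumTo-swap n n _) ⟩
      sumTo n (λ i → sumTo n (λ j → sumTo n (λ k → p i * (g ^ₛ i) k * (q j * (g ^ₛ j) (n ∸ k)))))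
        ≡⟨ sumTo-cong n (λ i → sumTo-cong n (λ j →
             trans (sumTo-cong n (λ k → interchange (p i) ((g ^ₛ i) k) (q j) ((g ^ₛ j) (n ∸ k))))
                   (sym (*-distribˡ-sumTo n (p i * q j) _)))) ⟩
      sumTo n (λ i → sumTo n (λ j → p i * q j * ((g ^ₛ i) ⊛ (g ^ₛ j)) n))
        ≡⟨ sumTo-cong n (λ i → sumTo-cong n (λ j → cong (p i * q j *_) (sym (^ₛ-+ g i j n)))) ⟩
      T ∎

  ∘ₛ-^ₛ : ∀ f k → (f ^ₛ k) ∘ₛ g ≗ (f ∘ₛ g) ^ₛ k
  ∘ₛ-^ₛ f zero      = δ₀-∘ₛ g
  ∘ₛ-^ₛ f (suc k) n = trans (∘ₛ-⊛ f (f ^ₛ k) n) (⊛-congˡ (f ∘ₛ g) (∘ₛ-^ₛ f k) n)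

  D-∘ₛ : ∀ f → D (f ∘ₛ g) ≗ (D f ∘ₛ g) ⊛ D g
  D-∘ₛ f n = begin
    D (f ∘ₛ g) n
      ≡⟨ termwise ⟩
    sumTo n (λ l → D f l * ((g ^ₛ l) ⊛ D g) n)
      ≡⟨ sumTo-cong n (λ l → *-distribˡ-sumTo n (D f l) _) ⟩
    sumTo n (λ l → sumTo n (λ j → D f l * ((g ^ₛ l) j * D g (n ∸ j))))
      ≡⟨ sumTo-swap n n _ ⟩
    sumTo n (λ j → sumTo n (λ l → D f l * ((g ^ₛ l) j * D g (n ∸ j))))
      ≡⟨ sumTo-cong n (λ j → trans (sumTo-cong n (λ l → sym (*-assoc (D f l) _ _)))
                                   (sym (*-distribʳ-sumTo n _ _))) ⟩
    sumTo n (λ j → sumTo n (λ l → D f l * (g ^ₛ l) j) * D g (n ∸ j))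
      ≡⟨ sumTo-cong-≤ n (λ j j≤n → cong (_* D g (n ∸ j)) (sym (∘ₛ-extend (D f) j≤n))) ⟩
    ((D f ∘ₛ g) ⊛ D g) n
      ∎
    where
    open ≡-Reasoning
    s = fromℕ (suc n)
    termwise : D (f ∘ₛ g) n ≡ sumTo n (λ l → D f l * ((g ^ₛ l) ⊛ D g) n)
    termwise = begin
      s * sumTo (suc n) (λ l → f l * (g ^ₛ l) (suc n))
        ≡⟨ *-distribˡ-sumTo (suc n) s _ ⟩
      sumTo (suc n) (λ l → s * (f l * (g ^ₛ l) (suc n)))
        ≡⟨ sumTo-cong (suc n) (λ l → x∙yz≈y∙xz s (f l) ((g ^ₛ l) (suc n))) ⟩
      sumTo (suc n) (λ l → f l * D (g ^ₛ l) n)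
        ≡⟨ sumTo-suc n _ ⟩
      f 0 * (s * 0ℚ) + sumTo n (λ l → f (suc l) * D (g ^ₛ suc l) n)
        ≡⟨ cong₂ _+_ (trans (cong (f 0 *_) (*-zeroʳ s)) (*-zeroʳ (f 0)))
                     (sumTo-cong n (λ l → cong (f (suc l) *_) (D-^ₛ g l n))) ⟩
      0ℚ + sumTo n (λ l → f (suc l) * (fromℕ (suc l) * ((g ^ₛ l) ⊛ D g) n))
        ≡⟨ +-identityˡ _ ⟩
      sumTo n (λ l → f (suc l) * (fromℕ (suc l) * ((g ^ₛ l) ⊛ D g) n))
        ≡⟨ sumTo-cong n (λ l → x∙yz≈yx∙z (f (suc l)) (fromℕ (suc l)) (((g ^ₛ l) ⊛ D g) n)) ⟩
      sumTo n (λ l → D f l * ((g ^ₛ l) ⊛ D g) n)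
        ∎

-- The degenerate exponential

fromℕ[n!]*expλ : ∀ lam c n → fromℕ (n !) * expλ lam c n ≡ fallλ lam c n
fromℕ[n!]*expλ lam c n = begin
  fromℕ (n !) * (fallλ lam c n * invFact n)  ≡⟨ x∙yz≈y∙xz (fromℕ (n !)) (fallλ lam c n) (invFact n) ⟩
  fallλ lam c n * (fromℕ (n !) * invFact n)  ≡⟨ cong (fallλ lam c n *_) (fromℕ[n!]*invFact n) ⟩
  fallλ lam c n * 1ℚ                         ≡⟨ *-identityʳ (fallλ lam c n) ⟩
  fallλ lam c n                              ∎
  where open ≡-Reasoning

expλ-zero : ∀ lam → expλ lam 0ℚ ≗ δ₀
expλ-zero lam zero    = refl
expλ-zero lam (suc n) = trans (cong (_* invFact (suc n)) (fall≡0 n)) (*-zeroˡ (invFact (suc n)))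
  where
  fall≡0 : ∀ n → fallλ lam 0ℚ (suc n) ≡ 0ℚ
  fall≡0 zero    = cong (λ a → 1ℚ * (0ℚ - a)) (*-zeroˡ lam)
  fall≡0 (suc n) = trans (cong (_* a) (fall≡0 n)) (*-zeroˡ a)
    where a = 0ℚ - fromℕ (suc n) * lam

D-expλ : ∀ lam c n → D (expλ lam c) n ≡ (c - fromℕ n * lam) * expλ lam c n
D-expλ lam c n = begin
  s * (F * a * I′)  ≡⟨ x∙yz≈yx∙z s (F * a) I′ ⟩
  F * a * s * I′    ≡⟨ *-assoc (F * a) s I′ ⟩
  F * a * (s * I′)  ≡⟨ cong (F * a *_) (fromℕ-suc*invFact-suc n) ⟩
  F * a * I         ≡⟨ cong (_* I) (*-comm F a) ⟩
  a * F * I         ≡⟨ *-assoc a F I ⟩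
  a * (F * I)       ∎
  where
  open ≡-Reasoning
  s = fromℕ (suc n)
  F = fallλ lam c n
  a = c - fromℕ n * lam
  I = invFact n
  I′ = invFact (suc n)

expλ-ode : ∀ lam c → (δ₀ ⊕ lam ·ₛ X) ⊛ D (expλ lam c) ≗ c ·ₛ expλ lam c
expλ-ode lam c n = begin
  ((δ₀ ⊕ lam ·ₛ X) ⊛ D e) n               ≡⟨ ⊛-distribʳ-⊕ δ₀ (lam ·ₛ X) (D e) n ⟩
  (δ₀ ⊛ D e) n + ((lam ·ₛ X) ⊛ D e) n     ≡⟨ cong₂ _+_ (⊛-identityˡ (D e) n) (⊛-·ˡ lam X (D e) n) ⟩
  D e n + lam * (X ⊛ D e) n               ≡⟨ coefficient n ⟩
  c * e n                                 ∎
  where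
  open ≡-Reasoning
  e = expλ lam c
  coefficient : ∀ n → D e n + lam * (X ⊛ D e) n ≡ c * e n
  coefficient zero = begin
    D e 0 + lam * (X ⊛ D e) 0        ≡⟨ cong₂ (λ a b → a + lam * b) (D-expλ lam c 0) (X⊛-zero (D e)) ⟩
    (c - 0ℚ * lam) * e 0 + lam * 0ℚ  ≡⟨ simplify c lam (e 0) ⟩
    c * e 0                          ∎
    where
    simplify : ∀ c lam e → (c - 0ℚ * lam) * e + lam * 0ℚ ≡ c * e
    simplify = solve-∀ ℚ-ring
  coefficient (suc n) = begin
    D e (suc n) + lam * (X ⊛ D e) (suc n)
      ≡⟨ cong₂ (λ a b → a + lam * b) (D-expλ lam c (suc n)) (X⊛-suc (D e) n) ⟩
    (c - s * lam) * e (suc n) + lam * (s * e (suc n))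
      ≡⟨ simplify c lam s (e (suc n)) ⟩
    c * e (suc n)
      ∎
    where
    s = fromℕ (suc n)
    simplify : ∀ c lam s e → (c - s * lam) * e + lam * (s * e) ≡ c * e
    simplify = solve-∀ ℚ-ring

expλ-+ : ∀ lam a b → expλ lam a ⊛ expλ lam b ≗ expλ lam (a + b)
expλ-+ lam a b = linear-ode-unique {B} {(a + b) ·ₛ δ₀} {Eᵃ ⊛ Eᵇ} {expλ lam (a + b)}
                   B₀≡1 refl odeProduct (odeExp (a + b))
  where
  open ≗-Reasoning
  B = δ₀ ⊕ lam ·ₛ X
  B₀≡1 : B 0 ≡ 1ℚ
  B₀≡1 = trans (cong (1ℚ +_) (*-zeroʳ lam)) (+-identityʳ 1ℚ)
  Eᵃ = expλ lam a
  Eᵇ = expλ lam b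
  scalar : ∀ c f → c ·ₛ f ≗ (c ·ₛ δ₀) ⊛ f
  scalar c f n = sym (trans (⊛-·ˡ c δ₀ f n) (cong (c *_) (⊛-identityˡ f n)))
  odeExp : ∀ c → B ⊛ D (expλ lam c) ≗ (c ·ₛ δ₀) ⊛ expλ lam c
  odeExp c = begin
    B ⊛ D (expλ lam c)      ≈⟨ expλ-ode lam c ⟩
    c ·ₛ expλ lam c         ≈⟨ scalar c (expλ lam c) ⟩
    (c ·ₛ δ₀) ⊛ expλ lam c  ∎
  odeProduct : B ⊛ D (Eᵃ ⊛ Eᵇ) ≗ ((a + b) ·ₛ δ₀) ⊛ (Eᵃ ⊛ Eᵇ)
  odeProduct = begin
    B ⊛ D (Eᵃ ⊛ Eᵇ)
      ≈⟨ ⊛-congˡ B (D-⊛ Eᵃ Eᵇ) ⟩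
    B ⊛ (D Eᵃ ⊛ Eᵇ ⊕ Eᵃ ⊛ D Eᵇ)
      ≈⟨ ⊛-distribˡ-⊕ B (D Eᵃ ⊛ Eᵇ) (Eᵃ ⊛ D Eᵇ) ⟩
    B ⊛ (D Eᵃ ⊛ Eᵇ) ⊕ B ⊛ (Eᵃ ⊛ D Eᵇ)
      ≈⟨ ⊕-cong (⊛-assoc B (D Eᵃ) Eᵇ) (⊛-comm (Eᵃ ⊛ D Eᵇ) B) ⟨
    (B ⊛ D Eᵃ) ⊛ Eᵇ ⊕ (Eᵃ ⊛ D Eᵇ) ⊛ B
      ≈⟨ ⊕-congˡ ((B ⊛ D Eᵃ) ⊛ Eᵇ) (⊛-assoc Eᵃ (D Eᵇ) B) ⟩
    (B ⊛ D Eᵃ) ⊛ Eᵇ ⊕ Eᵃ ⊛ (D Eᵇ ⊛ B)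
      ≈⟨ ⊕-congˡ ((B ⊛ D Eᵃ) ⊛ Eᵇ) (⊛-congˡ Eᵃ (⊛-comm (D Eᵇ) B)) ⟩
    (B ⊛ D Eᵃ) ⊛ Eᵇ ⊕ Eᵃ ⊛ (B ⊛ D Eᵇ)
      ≈⟨ ⊕-cong (⊛-congʳ Eᵇ (expλ-ode lam a)) (⊛-congˡ Eᵃ (expλ-ode lam b)) ⟩
    (a ·ₛ Eᵃ) ⊛ Eᵇ ⊕ Eᵃ ⊛ (b ·ₛ Eᵇ)
      ≈⟨ ⊕-cong (⊛-·ˡ a Eᵃ Eᵇ) (⊛-·ʳ b Eᵃ Eᵇ) ⟩
    a ·ₛ (Eᵃ ⊛ Eᵇ) ⊕ b ·ₛ (Eᵃ ⊛ Eᵇ)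
      ≈⟨ (λ n → *-distribʳ-+ ((Eᵃ ⊛ Eᵇ) n) a b) ⟨
    (a + b) ·ₛ (Eᵃ ⊛ Eᵇ)
      ≈⟨ scalar (a + b) (Eᵃ ⊛ Eᵇ) ⟩
    ((a + b) ·ₛ δ₀) ⊛ (Eᵃ ⊛ Eᵇ)
      ∎

expλ-cancel : ∀ lam {a b} → a + b ≡ 0ℚ → expλ lam a ⊛ expλ lam b ≗ δ₀
expλ-cancel lam {a} {b} a+b≡0 n =
  trans (expλ-+ lam a b n) (trans (cong (λ c → expλ lam c n) a+b≡0) (expλ-zero lam n))

binom-⊛ : ∀ n (f g : Series) →
          sumTo n (λ l → binom n l * (fromℕ (l !) * f l) * (fromℕ ((n ∸ l) !) * g (n ∸ l)))
          ≡ fromℕ (n !) * (f ⊛ g) n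
binom-⊛ n f g = trans (sumTo-cong-≤ n term) (sym (*-distribˡ-sumTo n (fromℕ (n !)) _))
  where
  rearrange : ∀ c a x b y → c * (a * x) * (b * y) ≡ c * a * b * (x * y)
  rearrange = solve-∀ ℚ-ring
  term : ∀ l → l ℕ.≤ n → binom n l * (fromℕ (l !) * f l) * (fromℕ ((n ∸ l) !) * g (n ∸ l))
                         ≡ fromℕ (n !) * (f l * g (n ∸ l))
  term l l≤n = trans (rearrange (binom n l) (fromℕ (l !)) (f l) (fromℕ ((n ∸ l) !)) (g (n ∸ l)))
                     (cong (_* (f l * g (n ∸ l))) (binom*l!*[n∸l]!≡n! l≤n))

derangement-convolution : ∀ lam x n →
  sumTo n (λ l → binom n l * dλ lam x l * fallλ lam (1ℚ - x) (n ∸ l)) ≡ fromℕ (n !)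
derangement-convolution lam x n = begin
  sumTo n (λ l → binom n l * dλ lam x l * fallλ lam (1ℚ - x) (n ∸ l))
    ≡⟨ sumTo-cong n (λ l → cong (binom n l * dλ lam x l *_) (fromℕ[n!]*expλ lam (1ℚ - x) (n ∸ l))) ⟨
  sumTo n (λ l → binom n l * dλ lam x l * (fromℕ ((n ∸ l) !) * E¹⁻ˣ (n ∸ l)))
    ≡⟨ binom-⊛ n (geomSeries ⊛ Eˣ⁻¹) E¹⁻ˣ ⟩
  fromℕ (n !) * ((geomSeries ⊛ Eˣ⁻¹) ⊛ E¹⁻ˣ) n
    ≡⟨ cong (fromℕ (n !) *_) (⊛-assoc geomSeries Eˣ⁻¹ E¹⁻ˣ n) ⟩
  fromℕ (n !) * (geomSeries ⊛ (Eˣ⁻¹ ⊛ E¹⁻ˣ)) n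
    ≡⟨ cong (fromℕ (n !) *_) (⊛-congˡ geomSeries (expλ-cancel lam (x-1+1-x≡0 x)) n) ⟩
  fromℕ (n !) * (geomSeries ⊛ δ₀) n
    ≡⟨ cong (fromℕ (n !) *_) (⊛-identityʳ geomSeries n) ⟩
  fromℕ (n !) * 1ℚ
    ≡⟨ *-identityʳ (fromℕ (n !)) ⟩
  fromℕ (n !) ∎
  where
  open ≡-Reasoning
  Eˣ⁻¹ = expλ lam (x - 1ℚ)
  E¹⁻ˣ = expλ lam (1ℚ - x)
  x-1+1-x≡0 : ∀ x → (x - 1ℚ) + (1ℚ - x) ≡ 0ℚ
  x-1+1-x≡0 = solve-∀ ℚ-ring

-- The degenerate logarithm

module _ (lam : ℚ) .{{_ : NonZero lam}} where

  private
    L = logλ1+ lam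
    B = binomSeries lam
    E = expλ-1 lam

  logλ1+-zero : L 0 ≡ 0ℚ
  logλ1+-zero = *-zeroˡ (1/ lam)

  binomSeries≗1+λlogλ1+ : B ≗ δ₀ ⊕ lam ·ₛ L
  binomSeries≗1+λlogλ1+ n = sym (begin
    δ₀ n + lam * (y * 1/ lam)  ≡⟨ cong (δ₀ n +_) (x∙yz≈y∙xz lam y (1/ lam)) ⟩
    δ₀ n + y * (lam * 1/ lam)  ≡⟨ cong (λ i → δ₀ n + y * i) (*-inverseʳ lam) ⟩
    δ₀ n + y * 1ℚ              ≡⟨ cancel (δ₀ n) (B n) ⟩
    B n                        ∎)
    where
    open ≡-Reasoning
    y = B n - δ₀ n
    cancel : ∀ d b → d + (b - d) * 1ℚ ≡ b
    cancel = solve-∀ ℚ-ring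

  binomSeries≗[1+λX]∘ₛlogλ1+ : B ≗ (δ₀ ⊕ lam ·ₛ X) ∘ₛ L
  binomSeries≗[1+λX]∘ₛlogλ1+ = begin
    B                          ≈⟨ binomSeries≗1+λlogλ1+ ⟩
    δ₀ ⊕ lam ·ₛ L              ≈⟨ ⊕-cong (δ₀-∘ₛ L) (·ₛ-congˡ lam (X-∘ₛ logλ1+-zero)) ⟨
    δ₀ ∘ₛ L ⊕ lam ·ₛ X ∘ₛ L    ≈⟨ ⊕-congˡ (δ₀ ∘ₛ L) (∘ₛ-· lam X L) ⟨
    δ₀ ∘ₛ L ⊕ (lam ·ₛ X) ∘ₛ L  ≈⟨ ∘ₛ-⊕ δ₀ (lam ·ₛ X) L ⟨
    (δ₀ ⊕ lam ·ₛ X) ∘ₛ L       ∎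
    where open ≗-Reasoning

  D-logλ1+ : D L ≗ 1/ lam ·ₛ D B
  D-logλ1+ n = rearrange (fromℕ (suc n)) (B (suc n)) (1/ lam)
    where
    rearrange : ∀ s b i → s * ((b - 0ℚ) * i) ≡ i * (s * b)
    rearrange = solve-∀ ℚ-ring

  expλ∘ₛlogλ1+ : expλ lam 1ℚ ∘ₛ L ≗ δ₀ ⊕ 1ℚ ·ₛ X
  expλ∘ₛlogλ1+ = linear-ode-unique {B} {D L} {e ∘ₛ L} {H} refl refl odeComposite odeLinear
    where
    open ≗-Reasoning
    e = expλ lam 1ℚ
    H = δ₀ ⊕ 1ℚ ·ₛ X
    odeComposite : B ⊛ D (e ∘ₛ L) ≗ D L ⊛ (e ∘ₛ L)
    odeComposite = begin
      B ⊛ D (e ∘ₛ L)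
        ≈⟨ ⊛-congˡ B (D-∘ₛ logλ1+-zero e) ⟩
      B ⊛ ((D e ∘ₛ L) ⊛ D L)
        ≈⟨ ⊛-assoc B (D e ∘ₛ L) (D L) ⟨
      (B ⊛ (D e ∘ₛ L)) ⊛ D L
        ≈⟨ ⊛-congʳ (D L) (⊛-congʳ (D e ∘ₛ L) binomSeries≗[1+λX]∘ₛlogλ1+) ⟩
      (((δ₀ ⊕ lam ·ₛ X) ∘ₛ L) ⊛ (D e ∘ₛ L)) ⊛ D L
        ≈⟨ ⊛-congʳ (D L) (∘ₛ-⊛ logλ1+-zero (δ₀ ⊕ lam ·ₛ X) (D e)) ⟨
      (((δ₀ ⊕ lam ·ₛ X) ⊛ D e) ∘ₛ L) ⊛ D L
        ≈⟨ ⊛-congʳ (D L) (∘ₛ-cong L (λ n → trans (expλ-ode lam 1ℚ n) (*-identityˡ (e n)))) ⟩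
      (e ∘ₛ L) ⊛ D L
        ≈⟨ ⊛-comm (e ∘ₛ L) (D L) ⟩
      D L ⊛ (e ∘ₛ L)
        ∎
    D[1+X]≗δ₀ : D H ≗ δ₀
    D[1+X]≗δ₀ zero    = refl
    D[1+X]≗δ₀ (suc n) = *-zeroʳ (fromℕ (suc (suc n)))
    1/λ·λ·B≗B : 1/ lam ·ₛ lam ·ₛ B ≗ B
    1/λ·λ·B≗B n = trans (sym (*-assoc (1/ lam) lam (B n)))
                        (trans (cong (_* B n) (*-inverseˡ lam)) (*-identityˡ (B n)))
    odeLinear : B ⊛ D H ≗ D L ⊛ H
    odeLinear = begin
      B ⊛ D H                 ≈⟨ ⊛-congˡ B D[1+X]≗δ₀ ⟩
      B ⊛ δ₀                  ≈⟨ ⊛-identityʳ B ⟩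
      B                       ≈⟨ 1/λ·λ·B≗B ⟨
      1/ lam ·ₛ lam ·ₛ B      ≈⟨ ·ₛ-congˡ (1/ lam) (expλ-ode 1ℚ lam) ⟨
      1/ lam ·ₛ H ⊛ D B       ≈⟨ ·ₛ-congˡ (1/ lam) (⊛-comm H (D B)) ⟩
      1/ lam ·ₛ D B ⊛ H       ≈⟨ ⊛-·ˡ (1/ lam) (D B) H ⟨
      (1/ lam ·ₛ D B) ⊛ H     ≈⟨ ⊛-congʳ H D-logλ1+ ⟨
      D L ⊛ H                 ∎

  expλ-1∘ₛlogλ1+ : E ∘ₛ L ≗ X
  expλ-1∘ₛlogλ1+ n = begin
    (E ∘ₛ L) n                          ≡⟨ ∘ₛ-⊖ (expλ lam 1ℚ) δ₀ L n ⟩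
    (expλ lam 1ℚ ∘ₛ L) n - (δ₀ ∘ₛ L) n  ≡⟨ cong₂ _-_ (expλ∘ₛlogλ1+ n) (δ₀-∘ₛ L n) ⟩
    (δ₀ n + 1ℚ * X n) - δ₀ n            ≡⟨ cancel (δ₀ n) (X n) ⟩
    X n                                 ∎
    where
    open ≡-Reasoning
    cancel : ∀ d x → (d + 1ℚ * x) - d ≡ x
    cancel = solve-∀ ℚ-ring

  Fλ*S1λ : ∀ n l → Fλ lam 1ℚ l * S1λ lam n l
                   ≡ fromℕ (n !) * (sumTo l (λ k → (E ^ₛ k) l) * (L ^ₛ l) n)
  Fλ*S1λ n l = begin
    fromℕ (l !) * A′ * (N * (invFact l * Q))  ≡⟨ rearrange (fromℕ (l !)) A′ N (invFact l) Q ⟩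
    N * (A′ * Q) * (fromℕ (l !) * invFact l)  ≡⟨ cong (N * (A′ * Q) *_) (fromℕ[n!]*invFact l) ⟩
    N * (A′ * Q) * 1ℚ                         ≡⟨ *-identityʳ (N * (A′ * Q)) ⟩
    N * (A′ * Q)                              ≡⟨ cong (λ A → N * (A * Q)) (sumTo-cong l 1^k*Eᵏ≡Eᵏ) ⟩
    N * (sumTo l (λ k → (E ^ₛ k) l) * Q)      ∎
    where
    open ≡-Reasoning
    N = fromℕ (n !)
    Q = (L ^ₛ l) n
    A′ = sumTo l (λ k → (1ℚ ^ℚ k) * (E ^ₛ k) l)
    1^k*Eᵏ≡Eᵏ : ∀ k → (1ℚ ^ℚ k) * (E ^ₛ k) l ≡ (E ^ₛ k) l
    1^k*Eᵏ≡Eᵏ k = trans (cong (_* (E ^ₛ k) l) (^ℚ-zeroˡ k)) (*-identityˡ ((E ^ₛ k) l))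
    rearrange : ∀ p A N I Q → p * A * (N * (I * Q)) ≡ N * (A * Q) * (p * I)
    rearrange = solve-∀ ℚ-ring

  fubini-stirling : ∀ n → sumTo n (λ l → Fλ lam 1ℚ l * S1λ lam n l) ≡ fromℕ (n !)
  fubini-stirling n = begin
    sumTo n (λ l → Fλ lam 1ℚ l * S1λ lam n l)
      ≡⟨ sumTo-cong n (Fλ*S1λ n) ⟩
    sumTo n (λ l → N * (sumTo l (λ k → (E ^ₛ k) l) * (L ^ₛ l) n))
      ≡⟨ *-distribˡ-sumTo n N _ ⟨
    N * sumTo n (λ l → sumTo l (λ k → (E ^ₛ k) l) * (L ^ₛ l) n)
      ≡⟨ cong (N *_) (sumTo-cong-≤ n (λ l l≤n →
           cong (_* (L ^ₛ l) n) (sumTo-extend l≤n (λ k → ^ₛ-vanish refl)))) ⟨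
    N * sumTo n (λ l → sumTo n (λ k → (E ^ₛ k) l) * (L ^ₛ l) n)
      ≡⟨ cong (N *_) (sumTo-cong n (λ l → *-distribʳ-sumTo n ((L ^ₛ l) n) _)) ⟩
    N * sumTo n (λ l → sumTo n (λ k → (E ^ₛ k) l * (L ^ₛ l) n))
      ≡⟨ cong (N *_) (sumTo-swap n n _) ⟩
    N * sumTo n (λ k → ((E ^ₛ k) ∘ₛ L) n)
      ≡⟨ cong (N *_) (sumTo-cong n (λ k →
           trans (∘ₛ-^ₛ logλ1+-zero E k n) (^ₛ-cong k expλ-1∘ₛlogλ1+ n))) ⟩
    N * sumTo n (λ k → (X ^ₛ k) n)
      ≡⟨ cong (N *_) (trans (sumTo-last n (λ k → X^ₛ-below)) (X^ₛ-diag n)) ⟩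
    N * 1ℚ
      ≡⟨ *-identityʳ N ⟩
    N ∎
    where
    open ≡-Reasoning
    N = fromℕ (n !)

theorem5 : (lam : ℚ) → .{{_ : NonZero lam}} → (x : ℚ) → (n : ℕ) →
    (sumTo n (λ l → Fλ lam 1ℚ l * S1λ lam n l)
      ≡ sumTo n (λ l → binom n l * dλ₀ lam l * fallλ lam 1ℚ (n ∸ l)))
    × (sumTo n (λ l → binom n l * dλ₀ lam l * fallλ lam 1ℚ (n ∸ l))
      ≡ sumTo n (λ l → binom n l * dλ lam x l * fallλ lam (1ℚ - x) (n ∸ l)))
theorem5 lam x n =
  trans (fubini-stirling lam n) (sym (derangement-convolution lam 0ℚ n)) ,
  trans (derangement-convolution lam 0ℚ n) (sym (derangement-convolution lam x n))
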